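{- Run algorithm $\mathrm{Square}$ (defined in the context) on requests $r_1,\dots,r_N$. Let $r_i$ be an uncovered request having at least two children, and let $j,k$ be children of $i$ with $k<j$. Then $t_j-\rho(j)\ge t_k+4\rho(k)$.
   Context: Time-line graph: nodes $0,1,\dots,n$ of a directed line; replicas $(v,t)$, $t\in\{0,1,2,\dots\}$; horizontal edges $((u,t),(u+1,t))$ and arcs $((v,t),(v,t+1))$. Requests $r_i=(v_i,t_i)$, $i=1,\dots,N$, with $0\le t_1\le\dots\le t_N$. $d_\infty((u,s),(v,t))=\max\{t-s,v-u\}$ if $s\le t,u\le v$, else $\infty$. Algorithm $\mathrm{Square}$: start with $F=\{(0,0)\}$, $t_0=0$. For $i=1,\dots,N$: (SQ1) add arcs from $(0,t_{i-1})$ to $(0,t_i)$; (SQ2) $\rho(i)=\min\{d_\infty(q,r_i): q\text{ a replica of }F\}$; (SQ3) among replicas of $F$ in $[v_i-5\rho(i),v_i]\times[t_i-5\rho(i),t_i]$ choose $q_i=(u_i,s_i)$ with $u_i$ minimal (ties arbitrary); (SQ4) add arcs from $(u_i,s_i)$ to $(u_i,t_i)$ and horizontal edges from $(u_i,t_i)$ to $(v_i,t_i)$; (SQ5) add arcs from $(u_i,t_i)$ to $(u_i,t_i+4\rho(i))$. Request $r_i$ is covered if $v_i-u_i\ge\rho(i)$, uncovered otherwise. Quarter-ball $Q(i)$: the subgraph of the time-line graph consisting of replicas $(u,s)$ with $u\le v_i$, $s\le t_i$, $(v_i-u)+(t_i-s)\le\rho(i)$, with the edges between them. For an uncovered request $r_j$,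 its parent is the minimal index $i>j$ such that $r_i$ is uncovered and $Q(i)$ and $Q(j)$ are not edge disjoint (if it exists); $j$ is then a child of $i$. -}

module Defs where

open import Data.Nat using (ℕ; zero; suc; _+_; _*_; _∸_; _≤_; _<_; _⊔_)
open import Data.Product using (_×_; Σ; ∃; _,_)
open import Relation.Nullary using (¬_)
open import Relation.Binary.PropositionalEquality using (_≡_)

-- A replica (u , s) of the time-line graph: node u, time s.
Replica : Set
Replica = ℕ × ℕ

-- Requests are given by v t : ℕ → ℕ ; request r_i = (v i , t i) for 1 ≤ i ≤ N.
-- Values at index 0 are irrelevant; the paper's convention t_0 = 0 is tPrev.
tPrev : (ℕ → ℕ) → ℕ → ℕ
tPrev t zero = 0
tPrev t (suc zero) = 0
tPrev t (suc (suc k)) = t (suc k)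

-- d∞((a,b),(c,d)) when a ≤ c and b ≤ d (otherwise ∞, handled by callers)
dInf : Replica → Replica → ℕ
dInf (a , b) (c , d) = (d ∸ b) ⊔ (c ∸ a)

-- Replicas of F at step i of Square, after (SQ1) of step i, i.e. at (SQ2)/(SQ3).
-- u s ρ record the choices q_k = (u k , s k) and radii ρ(k) of earlier steps.
data InF (v t u s ρ : ℕ → ℕ) (i : ℕ) : Replica → Set where
  init  : InF v t u s ρ i (0 , 0)
  sq1   : ∀ k b → 1 ≤ k → k ≤ i → tPrev t k ≤ b → b ≤ t k →
          InF v t u s ρ i (0 , b)
  -- (SQ4) arcs (u_k,s_k) → (u_k,t_k) and (SQ5) arcs (u_k,t_k) → (u_k,t_k+4ρ(k)), k < i
  sq45  : ∀ k b → 1 ≤ k → k < i → s k ≤ b → b ≤ t k + 4 * ρ k →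
          InF v t u s ρ i (u k , b)
  sq4h  : ∀ k a → 1 ≤ k → k < i → u k ≤ a → a ≤ v k →
          InF v t u s ρ i (a , t k)

-- q ≤ r componentwise, i.e. d∞(q,r) < ∞
Below : Replica → Replica → Set
Below (a , b) (c , d) = (a ≤ c) × (b ≤ d)

-- A run of Square on requests r_1..r_N (with arbitrary tie breaking in SQ3).
record Run (N : ℕ) (v t : ℕ → ℕ) : Set where
  field
    u s ρ : ℕ → ℕ
    ρ-attained : ∀ i → 1 ≤ i → i ≤ N →
      Σ Replica λ q → InF v t u s ρ i q × Below q (v i , t i) × (dInf q (v i , t i) ≡ ρ i)
    ρ-minimal : ∀ i → 1 ≤ i → i ≤ N → ∀ q → InF v t u s ρ i q →
      Below q (v i , t i) → ρ i ≤ dInf q (v i , t i)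
    q-in-F : ∀ i → 1 ≤ i → i ≤ N → InF v t u s ρ i (u i , s i)
    q-box  : ∀ i → 1 ≤ i → i ≤ N →
      (u i ≤ v i) × (v i ≤ u i + 5 * ρ i) × (s i ≤ t i) × (t i ≤ s i + 5 * ρ i)
    q-min  : ∀ i → 1 ≤ i → i ≤ N → ∀ a b → InF v t u s ρ i (a , b) →
      a ≤ v i → v i ≤ a + 5 * ρ i → b ≤ t i → t i ≤ b + 5 * ρ i → u i ≤ a

module _ {N : ℕ} {v t : ℕ → ℕ} (R : Run N v t) where
  open Run R

  Covered : ℕ → Set
  Covered i = ρ i + u i ≤ v i

  Uncovered : ℕ → Set
  Uncovered i = ¬ Covered i

  InQ : ℕ → Replica → Set
  InQ i (a , b) = (a ≤ v i) × (b ≤ t i) × ((v i ∸ a) + (t i ∸ b) ≤ ρ i)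

  -- edges of the time-line graph: horizontal (a,b)–(a+1,b) and arcs (a,b)–(a,b+1)
  data Edge : Set where
    horiz : ℕ → ℕ → Edge
    arc   : ℕ → ℕ → Edge

  EdgeInQ : ℕ → Edge → Set
  EdgeInQ i (horiz a b) = InQ i (a , b) × InQ i (suc a , b)
  EdgeInQ i (arc a b)   = InQ i (a , b) × InQ i (a , suc b)

  Overlap : ℕ → ℕ → Set
  Overlap i j = ∃ λ e → EdgeInQ i e × EdgeInQ j e

  ChildOf : ℕ → ℕ → Set
  ChildOf j i = (1 ≤ j) × Uncovered j × (j < i) × (i ≤ N) × Uncovered i × Overlap i j ×
    (∀ i' → j < i' → i' < i → Uncovered i' → ¬ Overlap i' j)

-- Both children lie strictly to the right of v_i: a replica of F at time t_x and node
-- min(v_x, v_i), for a child x, would dominate the edge Q(i) shares with Q(x) and hence be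
-- closer to r_i than ρ(i).  Sharing an edge with Q(i) also gives v_x ≤ v_i + ρ(x).
-- Now suppose t_j < t_k + 4ρ(k) + ρ(j).  If u_k ≤ v_j, the SQ5 tower above q_k passes
-- within time ρ(j) of r_j, so v_j − u_k ≥ ρ(j) and u_k ≤ v_i: impossible.  If v_j < u_k,
-- the nearest replica to the uncovered r_j is (a, b*) with b* = t_j − ρ(j) and v_i < a;
-- moreover t_k ≤ b*, for otherwise Q(j) and Q(k) would share a horizontal edge, although
-- k < j < i and i is the parent of k.  Every replica of F in the window (v_i, v_j] × [t_k − 5ρ(k), b*]
-- was added for some request m: m < k would have offered a better q_k, m = k lies right of
-- the window, and for m > k the SQ5 tower of m stops below b* (else it is closer to r_j than
-- ρ(j)), so ρ(m) ≤ ρ(k) and q_m is again in the window.  The index strictly decreases, so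
-- the window is empty, contradicting that it contains (a, b*).  (A horizontal segment of
-- such an m reaching back to column v_i is excluded as in the first step, using Q(k).)

module Submission where

open import Defs
open import Data.Nat using (ℕ; zero; suc; pred; _+_; _*_; _∸_; _⊓_; _≤_; _<_; z<s; s≤s; s≤s⁻¹; _≤?_;
  NonZero; >-nonZero; >-nonZero⁻¹)
open import Data.Nat.Properties
open import Data.Nat.Induction using (<-rec)
open import Data.Product using (Σ; _×_; _,_; proj₁; proj₂)
open import Data.Sum using (_⊎_; inj₁; inj₂; [_,_]′; map)
open import Function using (_∘_)
open import Data.Empty using (⊥; ⊥-elim)
open import Relation.Nullary using (¬_; yes; no)
open import Relation.Binary using (tri<; tri≈; tri>)
open import Relation.Binary.PropositionalEquality using (_≡_; refl; sym; trans; cong; subst)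

stepwise-mono : ∀ {n} (f : ℕ → ℕ) → (∀ i → 1 ≤ i → i < n → f i ≤ f (suc i)) →
                ∀ {a b} → 1 ≤ a → a ≤ b → b ≤ n → f a ≤ f b
stepwise-mono f step {b = zero} (s≤s _) () _
stepwise-mono f step {a} {suc b} 1≤a a≤1+b 1+b≤n with m≤n⇒m<n∨m≡n a≤1+b
... | inj₂ refl = ≤-refl
... | inj₁ a<1+b = ≤-trans (stepwise-mono f step 1≤a a≤b (<⇒≤ 1+b≤n))
                           (step b (≤-trans 1≤a a≤b) 1+b≤n)
  where
  a≤b : a ≤ b
  a≤b = s≤s⁻¹ a<1+b

module _ {N : ℕ} {v t : ℕ → ℕ} (R : Run N v t) where
  open Run R

  F : ℕ → Replica → Set
  F = InF v t u s ρ

  no-replica-nearer-than-ρ : ∀ {x a b} → 1 ≤ x → x ≤ N → F x (a , b) → a ≤ v x → b ≤ t x →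
                             v x ∸ a < ρ x → t x ∸ b < ρ x → ⊥
  no-replica-nearer-than-ρ 1≤x x≤N f a≤ b≤ close-v close-t =
    <-irrefl refl (<-≤-trans (⊔-lub close-t close-v) (ρ-minimal _ 1≤x x≤N _ f (a≤ , b≤)))

  uncovered⇒ρ≢0 : ∀ {x} → 1 ≤ x → x ≤ N → Uncovered R x → NonZero (ρ x)
  uncovered⇒ρ≢0 {x} 1≤x x≤N unc with ρ x
  ... | zero = ⊥-elim (unc (proj₁ (q-box x 1≤x x≤N)))
  ... | suc _ = >-nonZero z<s

  uncovered-nearest-replica : ∀ {x} → 1 ≤ x → x ≤ N → Uncovered R x →
    Σ Replica λ { (a , b) → F x (a , b) × u x ≤ a × a ≤ v x × b + ρ x ≡ t x }
  uncovered-nearest-replica {x} 1≤x x≤N unc with ρ-attained x 1≤x x≤N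
  ... | (a , b) , f , (a≤ , b≤) , d≡ρ = (a , b) , f , ux≤a , a≤ , b+ρ≡t
    where
    dt≤ρ : t x ∸ b ≤ ρ x
    dt≤ρ = subst (t x ∸ b ≤_) d≡ρ (m≤m⊔n _ _)
    dv≤ρ : v x ∸ a ≤ ρ x
    dv≤ρ = subst (v x ∸ a ≤_) d≡ρ (m≤n⊔m _ _)
    ux≤a : u x ≤ a
    ux≤a = q-min x 1≤x x≤N a b f a≤
             (≤-trans (m≤n+m∸n (v x) a) (+-monoʳ-≤ a (≤-trans dv≤ρ (m≤n*m (ρ x) 5)))) b≤
             (≤-trans (m≤n+m∸n (t x) b) (+-monoʳ-≤ b (≤-trans dt≤ρ (m≤n*m (ρ x) 5))))
    dv<ρ : v x ∸ a < ρ x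
    dv<ρ = m<n+o⇒m∸n<o (v x) a {{uncovered⇒ρ≢0 1≤x x≤N unc}}
             (<-≤-trans (≰⇒> unc) (≤-trans (+-monoʳ-≤ (ρ x) ux≤a) (≤-reflexive (+-comm (ρ x) a))))
    dt≡ρ : t x ∸ b ≡ ρ x
    dt≡ρ with ⊔-sel (t x ∸ b) (v x ∸ a)
    ... | inj₁ d≡dt = trans (sym d≡dt) d≡ρ
    ... | inj₂ d≡dv = ⊥-elim (<-irrefl (trans (sym d≡dv) d≡ρ) dv<ρ)
    b+ρ≡t : b + ρ x ≡ t x
    b+ρ≡t = subst (λ z → b + z ≡ t x) dt≡ρ (m+[n∸m]≡n b≤)

  edge-head : Edge R → Replica
  edge-head (horiz a b) = suc a , b
  edge-head (arc a b)   = a , suc b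

  edge-head-in-Q : ∀ {x} e → EdgeInQ R x e → InQ R x (edge-head e)
  edge-head-in-Q (horiz _ _) = proj₂
  edge-head-in-Q (arc _ _)   = proj₂

  beyond-edge-of-Q : ∀ {x c d} e → EdgeInQ R x e → Below (edge-head e) (c , d) →
                     c ≤ v x → d ≤ t x → (v x ∸ c) + (t x ∸ d) < ρ x
  beyond-edge-of-Q {x} (horiz a b) ((_ , _ , tail-close) , _) (a<c , b≤d) c≤ d≤ =
    <-≤-trans (+-mono-<-≤ (∸-monoʳ-< a<c c≤) (∸-monoʳ-≤ (t x) b≤d)) tail-close
  beyond-edge-of-Q {x} (arc a b) ((_ , _ , tail-close) , _) (a≤c , b<d) c≤ d≤ =
    <-≤-trans (+-mono-≤-< (∸-monoʳ-≤ (v x) a≤c) (∸-monoʳ-< b<d d≤)) tail-close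

  overlap⇒no-replica-above-child : ∀ {i x c d} → 1 ≤ i → i ≤ N → Overlap R i x → F i (c , d) →
                   c ≤ v i → d ≤ t i → v x ≤ c ⊎ v i ≤ c → t x ≤ d → ⊥
  overlap⇒no-replica-above-child {i} {x} {c} {d} 1≤i i≤N (e , e∈Qi , e∈Qx) f c≤ d≤ right-of-head tx≤d =
    no-replica-nearer-than-ρ 1≤i i≤N f c≤ d≤
      (≤-<-trans (m≤m+n _ _) close) (≤-<-trans (m≤n+m _ _) close)
    where
    head∈Qi : InQ R i (edge-head e)
    head∈Qi = edge-head-in-Q e e∈Qi
    head∈Qx : InQ R x (edge-head e)
    head∈Qx = edge-head-in-Q e e∈Qx
    head≤c : proj₁ (edge-head e) ≤ c
    head≤c = [ ≤-trans (proj₁ head∈Qx) , ≤-trans (proj₁ head∈Qi) ]′ right-of-head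
    close : (v i ∸ c) + (t i ∸ d) < ρ i
    close = beyond-edge-of-Q e e∈Qi (head≤c , ≤-trans (proj₁ (proj₂ head∈Qx)) tx≤d) c≤ d≤

  overlap⇒v≤v+ρ : ∀ {i x} → Overlap R i x → v x ≤ v i + ρ x
  overlap⇒v≤v+ρ {i} {x} (e , e∈Qi , e∈Qx) =
    ≤-trans (m≤n+m∸n (v x) a) (+-mono-≤ a≤vi (≤-trans (m≤m+n _ _) a-close))
    where
    a : ℕ
    a = proj₁ (edge-head e)
    a≤vi : a ≤ v i
    a≤vi = proj₁ (edge-head-in-Q e e∈Qi)
    a-close : (v x ∸ a) + (t x ∸ proj₂ (edge-head e)) ≤ ρ x
    a-close = proj₂ (proj₂ (edge-head-in-Q e e∈Qx))

  horizontal-overlap : ∀ {x y w} → v x ≡ suc w → v x ≤ v y → v y ≤ w + ρ y →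
                       t y ≤ t x → t x ∸ t y < ρ x → Overlap R x y
  horizontal-overlap {x} {y} {w} vx≡1+w vx≤vy vy≤w+ρ ty≤tx close =
    horiz w (t y) , (tail∈Qx , head∈Qx) , (tail∈Qy , head∈Qy)
    where
    1+w≤vx : suc w ≤ v x
    1+w≤vx = ≤-reflexive (sym vx≡1+w)
    vx∸w≡1 : v x ∸ w ≡ 1
    vx∸w≡1 = trans (cong (_∸ w) vx≡1+w) (m+n∸n≡m 1 w)
    vx∸1+w≡0 : v x ∸ suc w ≡ 0
    vx∸1+w≡0 = trans (cong (_∸ suc w) vx≡1+w) (n∸n≡0 (suc w))
    vy∸w≤ρ : (v y ∸ w) + (t y ∸ t y) ≤ ρ y
    vy∸w≤ρ = subst (λ z → (v y ∸ w) + z ≤ ρ y) (sym (n∸n≡0 (t y)))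
               (≤-trans (≤-reflexive (+-identityʳ _)) (m≤n+o⇒m∸n≤o (v y) w vy≤w+ρ))
    tail∈Qx : InQ R x (w , t y)
    tail∈Qx = <⇒≤ 1+w≤vx , ty≤tx , subst (λ z → z + (t x ∸ t y) ≤ ρ x) (sym vx∸w≡1) close
    head∈Qx : InQ R x (suc w , t y)
    head∈Qx = 1+w≤vx , ty≤tx , subst (λ z → z + (t x ∸ t y) ≤ ρ x) (sym vx∸1+w≡0) (<⇒≤ close)
    tail∈Qy : InQ R y (w , t y)
    tail∈Qy = ≤-trans (<⇒≤ 1+w≤vx) vx≤vy , ≤-refl , vy∸w≤ρ
    head∈Qy : InQ R y (suc w , t y)
    head∈Qy = ≤-trans 1+w≤vx vx≤vy , ≤-refl ,
      ≤-trans (+-monoˡ-≤ (t y ∸ t y) (∸-monoʳ-≤ (v y) (n≤1+n w))) vy∸w≤ρ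

  module _ (t-mono : ∀ {a b} → 1 ≤ a → a ≤ b → b ≤ N → t a ≤ t b) where

    child-right-of-parent : ∀ {i x} → 1 ≤ x → x < i → i ≤ N → Overlap R i x → v i < u x
    child-right-of-parent {i} {x} 1≤x x<i i≤N i-over-x with u x ≤? v i
    ... | no ux≰vi = ≰⇒> ux≰vi
    ... | yes ux≤vi =
      ⊥-elim (overlap⇒no-replica-above-child (≤-trans 1≤x (<⇒≤ x<i)) i≤N i-over-x
                (sq4h x c 1≤x x<i (⊓-glb ux≤vx ux≤vi) (m⊓n≤m _ _))
                (m⊓n≤n _ _) (t-mono 1≤x (<⇒≤ x<i) i≤N)
                (map (≤-reflexive ∘ sym) (≤-reflexive ∘ sym) (⊓-sel (v x) (v i))) ≤-refl)
      where
      c : ℕ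
      c = v x ⊓ v i
      ux≤vx : u x ≤ v x
      ux≤vx = proj₁ (q-box x 1≤x (<⇒≤ (<-≤-trans x<i i≤N)))

    module Siblings {i j k : ℕ} (1≤k : 1 ≤ k) (k<j : k < j) (j<i : j < i) (i≤N : i ≤ N)
      (j-unc : Uncovered R j) (i-over-j : Overlap R i j) (i-over-k : Overlap R i k)
      (j-not-over-k : ¬ Overlap R j k) where

      1≤j : 1 ≤ j
      1≤j = ≤-trans 1≤k (<⇒≤ k<j)
      1≤i : 1 ≤ i
      1≤i = ≤-trans 1≤j (<⇒≤ j<i)
      j≤N : j ≤ N
      j≤N = <⇒≤ (<-≤-trans j<i i≤N)
      k≤N : k ≤ N
      k≤N = <⇒≤ (<-≤-trans k<j j≤N)

      instance
        ρj≢0 : NonZero (ρ j)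
        ρj≢0 = uncovered⇒ρ≢0 1≤j j≤N j-unc

      uj≤vj : u j ≤ v j
      uj≤vj = proj₁ (q-box j 1≤j j≤N)
      uk≤vk : u k ≤ v k
      uk≤vk = proj₁ (q-box k 1≤k k≤N)
      vi<uj : v i < u j
      vi<uj = child-right-of-parent 1≤j j<i i≤N i-over-j
      vi<uk : v i < u k
      vi<uk = child-right-of-parent 1≤k (<-trans k<j j<i) i≤N i-over-k
      vj≤vi+ρj : v j ≤ v i + ρ j
      vj≤vi+ρj = overlap⇒v≤v+ρ i-over-j
      vk≤vi+ρk : v k ≤ v i + ρ k
      vk≤vi+ρk = overlap⇒v≤v+ρ i-over-k
      tk≤tj : t k ≤ t j
      tk≤tj = t-mono 1≤k (<⇒≤ k<j) j≤N

      uk≤vj⇒far-apart : u k ≤ v j → t j < t k + 4 * ρ k + ρ j → ⊥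
      uk≤vj⇒far-apart uk≤vj too-close = <⇒≱ vi<uk uk≤vi
        where
        top : ℕ
        top = t k + 4 * ρ k
        b : ℕ
        b = t j ⊓ top
        sk≤tk : s k ≤ t k
        sk≤tk = proj₁ (proj₂ (proj₂ (q-box k 1≤k k≤N)))
        tower-point : F j (u k , b)
        tower-point = sq45 k b 1≤k k<j
          (⊓-glb (≤-trans sk≤tk tk≤tj) (≤-trans sk≤tk (m≤m+n _ _)))
          (m⊓n≤n _ _)
        tj<b+ρj : t j < b + ρ j
        tj<b+ρj = subst (t j <_) (sym (+-distribʳ-⊓ (ρ j) (t j) top))
                    (⊓-glb (m<m+n (t j) (>-nonZero⁻¹ (ρ j))) too-close)
        ρj≤vj∸uk : ρ j ≤ v j ∸ u k
        ρj≤vj∸uk = ≮⇒≥ λ near → no-replica-nearer-than-ρ 1≤j j≤N tower-point uk≤vj (m⊓n≤m _ _)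
                     near (m<n+o⇒m∸n<o (t j) b tj<b+ρj)
        uk≤vi : u k ≤ v i
        uk≤vi = +-cancelʳ-≤ (ρ j) (u k) (v i)
          (≤-trans (≤-reflexive (+-comm (u k) (ρ j)))
            (≤-trans (m≤o∸n⇒m+n≤o (ρ j) uk≤vj ρj≤vj∸uk) vj≤vi+ρj))

      vj<uk⇒tk+ρj≤tj : v j < u k → t k + ρ j ≤ t j
      vj<uk⇒tk+ρj≤tj vj<uk = ≮⇒≥ λ tj<tk+ρj → j-not-over-k
        (horizontal-overlap (sym (suc-pred (v j))) (<⇒≤ (<-≤-trans vj<uk uk≤vk))
          (≤-trans vk≤vi+ρk (+-monoˡ-≤ (ρ k) vi≤w)) tk≤tj (m<n+o⇒m∸n<o (t j) (t k) tj<tk+ρj))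
        where
        vi<vj : v i < v j
        vi<vj = <-≤-trans vi<uj uj≤vj
        instance
          vj≢0 : NonZero (v j)
          vj≢0 = >-nonZero (m<n⇒0<n vi<vj)
        vi≤w : v i ≤ pred (v j)
        vi≤w = suc[m]≤n⇒m≤pred[n] vi<vj

      above-k⇒1≤ : ∀ {m} → k < m → 1 ≤ m
      above-k⇒1≤ k<m = ≤-trans 1≤k (<⇒≤ k<m)

      below-j⇒≤N : ∀ {m} → m < j → m ≤ N
      below-j⇒≤N m<j = <⇒≤ (<-≤-trans m<j j≤N)

      module Descent (vj<uk : v j < u k) (b* : ℕ) (b*+ρj≡tj : b* + ρ j ≡ t j)
                     (b*<top : b* < t k + 4 * ρ k) where

        Window : Replica → Set
        Window (a , b) = (v i < a) × (a ≤ v j) × (b ≤ b*) × (t k ≤ b + 5 * ρ k)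

        k-box-misses-window : ∀ {c y} → F k (c , y) → v i < c → c ≤ v j →
                              y ≤ t k → t k ≤ y + 5 * ρ k → ⊥
        k-box-misses-window {c} {y} f vi<c c≤vj y≤tk tk≤y+5ρk =
          <⇒≱ (≤-<-trans c≤vj vj<uk)
            (q-min k 1≤k k≤N c y f (≤-trans c≤vj vj≤vk)
              (≤-trans vk≤vi+ρk (+-mono-≤ (<⇒≤ vi<c) (m≤n*m (ρ k) 5))) y≤tk tk≤y+5ρk)
          where
          vj≤vk : v j ≤ v k
          vj≤vk = <⇒≤ (<-≤-trans vj<uk uk≤vk)

        row-above-b*-misses-F : ∀ {c} → F j (c , suc b*) → v i < c → c ≤ v j → ⊥
        row-above-b*-misses-F f vi<c c≤vj =
          no-replica-nearer-than-ρ 1≤j j≤N f c≤vj 1+b*≤tj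
            (m<n+o⇒m∸n<o (v j) _ (≤-<-trans vj≤vi+ρj (+-monoˡ-< (ρ j) vi<c)))
            (m<n+o⇒m∸n<o (t j) (suc b*) (subst (_< suc b* + ρ j) b*+ρj≡tj ≤-refl))
          where
          1+b*≤tj : suc b* ≤ t j
          1+b*≤tj = subst (b* <_) b*+ρj≡tj (m<m+n b* (>-nonZero⁻¹ (ρ j)))

        tower-in-window : ∀ {m} → k < m → m < j → v i < u m → u m ≤ v j → s m ≤ b* →
                          Window (u m , s m)
        tower-in-window {m} k<m m<j vi<um um≤vj sm≤b* with t m + 4 * ρ m ≤? b*
        ... | no pokes-out = ⊥-elim (row-above-b*-misses-F
              (sq45 m (suc b*) (above-k⇒1≤ k<m) m<j (≤-trans sm≤b* (n≤1+n b*)) (≰⇒> pokes-out))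
              vi<um um≤vj)
        ... | yes ends = vi<um , um≤vj , sm≤b* , tk≤sm+5ρk
          where
          tk≤tm : t k ≤ t m
          tk≤tm = t-mono 1≤k (<⇒≤ k<m) (below-j⇒≤N m<j)
          ρm≤ρk : ρ m ≤ ρ k
          ρm≤ρk = *-cancelˡ-≤ 4 (+-cancelˡ-≤ (t k) _ _
                    (<⇒≤ (≤-<-trans (+-monoˡ-≤ (4 * ρ m) tk≤tm) (≤-<-trans ends b*<top))))
          tk≤sm+5ρk : t k ≤ s m + 5 * ρ k
          tk≤sm+5ρk = ≤-trans tk≤tm
            (≤-trans (proj₂ (proj₂ (proj₂ (q-box m (above-k⇒1≤ k<m) (below-j⇒≤N m<j)))))
              (+-monoʳ-≤ (s m) (*-monoʳ-≤ 5 ρm≤ρk)))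

        window-descent : ∀ {x a b} → x ≤ j → F x (a , b) → Window (a , b) →
                         Σ ℕ λ m → 1 ≤ m × m < x × Window (u m , s m)
        window-descent _ init (() , _)
        window-descent _ (sq1 _ _ _ _ _ _) (() , _)
        window-descent {x} x≤j (sq45 m b 1≤m m<x sm≤b b≤top) (vi<a , a≤vj , b≤b* , tk≤b+5ρk)
          with <-cmp m k
        ... | tri< m<k _ _ = ⊥-elim (k-box-misses-window
              (sq45 m (b ⊓ t k) 1≤m m<k (⊓-glb sm≤b (≤-trans sm≤tm tm≤tk))
                (≤-trans (m⊓n≤m _ _) b≤top))
              vi<a a≤vj (m⊓n≤n _ _)
              (subst (t k ≤_) (sym (+-distribʳ-⊓ (5 * ρ k) b (t k))) (⊓-glb tk≤b+5ρk (m≤m+n _ _))))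
          where
          m≤N : m ≤ N
          m≤N = <⇒≤ (<-≤-trans m<k k≤N)
          sm≤tm : s m ≤ t m
          sm≤tm = proj₁ (proj₂ (proj₂ (q-box m 1≤m m≤N)))
          tm≤tk : t m ≤ t k
          tm≤tk = t-mono 1≤m (<⇒≤ m<k) k≤N
        ... | tri≈ _ refl _ = ⊥-elim (<⇒≱ (≤-<-trans a≤vj vj<uk) ≤-refl)
        ... | tri> _ _ k<m =
              m , 1≤m , m<x , tower-in-window k<m (<-≤-trans m<x x≤j) vi<a a≤vj (≤-trans sm≤b b≤b*)
        window-descent {x} x≤j (sq4h m a 1≤m m<x um≤a a≤vm) (vi<a , a≤vj , b≤b* , tk≤b+5ρk)
          with <-cmp m k
        ... | tri< m<k _ _ = ⊥-elim (k-box-misses-window (sq4h m a 1≤m m<k um≤a a≤vm)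
              vi<a a≤vj (t-mono 1≤m (<⇒≤ m<k) k≤N) tk≤b+5ρk)
        ... | tri≈ _ refl _ = ⊥-elim (<⇒≱ (≤-<-trans a≤vj vj<uk) um≤a)
        ... | tri> _ _ k<m with u m ≤? v i
        ...   | yes um≤vi = ⊥-elim (overlap⇒no-replica-above-child 1≤i i≤N i-over-k
                (sq4h m (v i) 1≤m m<i um≤vi (<⇒≤ (<-≤-trans vi<a a≤vm))) ≤-refl
                (t-mono 1≤m (<⇒≤ m<i) i≤N) (inj₂ ≤-refl)
                (t-mono 1≤k (<⇒≤ k<m) (<⇒≤ (<-≤-trans m<i i≤N))))
          where
          m<i : m < i
          m<i = <-≤-trans m<x (≤-trans x≤j (<⇒≤ j<i))
        ...   | no um≰vi = m , 1≤m , m<x ,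
                tower-in-window k<m m<j (≰⇒> um≰vi) (≤-trans um≤a a≤vj) (≤-trans sm≤tm b≤b*)
          where
          m<j : m < j
          m<j = <-≤-trans m<x x≤j
          sm≤tm : s m ≤ t m
          sm≤tm = proj₁ (proj₂ (proj₂ (q-box m 1≤m (below-j⇒≤N m<j))))

        window-empty : ∀ x → x ≤ j → ∀ {a b} → F x (a , b) → Window (a , b) → ⊥
        window-empty = <-rec _ descend
          where
          descend : ∀ x → (∀ {y} → y < x → y ≤ j → ∀ {a b} → F y (a , b) → Window (a , b) → ⊥) →
                    x ≤ j → ∀ {a b} → F x (a , b) → Window (a , b) → ⊥
          descend x below x≤j f in-window with window-descent x≤j f in-window
          ... | m , 1≤m , m<x , q-in-window =
            below m<x m≤j (q-in-F m 1≤m (≤-trans m≤j j≤N)) q-in-window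
            where
            m≤j : m ≤ j
            m≤j = ≤-trans (<⇒≤ m<x) x≤j

      vj<uk⇒far-apart : v j < u k → t j < t k + 4 * ρ k + ρ j → ⊥
      vj<uk⇒far-apart vj<uk too-close with uncovered-nearest-replica 1≤j j≤N j-unc
      ... | (a , b) , f , uj≤a , a≤vj , b+ρj≡tj =
        Descent.window-empty vj<uk b b+ρj≡tj b<top j ≤-refl f
          (<-≤-trans vi<uj uj≤a , a≤vj , ≤-refl , ≤-trans tk≤b (m≤m+n b _))
        where
        b<top : b < t k + 4 * ρ k
        b<top = +-cancelʳ-< (ρ j) b (t k + 4 * ρ k)
                  (subst (_< t k + 4 * ρ k + ρ j) (sym b+ρj≡tj) too-close)
        tk≤b : t k ≤ b
        tk≤b = +-cancelʳ-≤ (ρ j) (t k) b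
                 (subst (t k + ρ j ≤_) (sym b+ρj≡tj) (vj<uk⇒tk+ρj≤tj vj<uk))

      sibling-gap : t k + 4 * ρ k + ρ j ≤ t j
      sibling-gap = ≮⇒≥ λ too-close →
        [ (λ uk≤vj → uk≤vj⇒far-apart uk≤vj too-close)
        , (λ vj<uk → vj<uk⇒far-apart vj<uk too-close) ]′ (≤-<-connex (u k) (v j))

lemma2 : (n N : ℕ) (v t : ℕ → ℕ) →
    (∀ i → 1 ≤ i → i ≤ N → v i ≤ n) →
    (∀ i → 1 ≤ i → i < N → t i ≤ t (suc i)) →
    (R : Run N v t) → (i j k : ℕ) →
    Uncovered R i → ChildOf R j i → ChildOf R k i → k < j →
    t k + 4 * Run.ρ R k + Run.ρ R j ≤ t j
lemma2 _ N v t _ t-step R i j k _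
  (_ , j-unc , j<i , i≤N , _ , i-over-j , _)
  (1≤k , _ , _ , _ , _ , i-over-k , no-overlap-between) k<j =
  Siblings.sibling-gap R (stepwise-mono t t-step)
    1≤k k<j j<i i≤N j-unc i-over-j i-over-k (no-overlap-between j k<j j<i j-unc)
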